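{- For every integer $n \geq 1$, \[ F_{2n} \;=\; \sum_{k=1}^{n} \binom{2n}{n+k} \left(\frac{k}{5}\right), \] where $F_m$ denotes the $m$-th Fibonacci number and $\left(\frac{k}{5}\right)$ is the Legendre symbol modulo $5$.
   Context: Fibonacci numbers: $F_0=0$, $F_1=1$, $F_{m}=F_{m-1}+F_{m-2}$. The Legendre symbol $\left(\frac{k}{5}\right)$ equals $0$ if $k\equiv 0 \pmod 5$, equals $1$ if $k\equiv 1,4 \pmod 5$, and equals $-1$ if $k \equiv 2,3 \pmod 5$. -}

module Defs where

open import Data.Nat using (ℕ; zero; suc; _+_; _%_)
open import Data.Nat.Combinatorics using (_C_)
open import Data.Integer as ℤ using (ℤ; +_; -_)

fib : ℕ → ℕ
fib zero = 0
fib (suc zero) = 1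
fib (suc (suc m)) = fib (suc m) + fib m

legendre5Res : ℕ → ℤ
legendre5Res 0 = + 0
legendre5Res 1 = + 1
legendre5Res 2 = - (+ 1)
legendre5Res 3 = - (+ 1)
legendre5Res 4 = + 1
legendre5Res _ = + 0   -- unreachable (argument is k % 5 < 5)

legendre5 : ℕ → ℤ
legendre5 k = legendre5Res (k % 5)

sumFrom1 : ℕ → (ℕ → ℤ) → ℤ
sumFrom1 zero f = + 0
sumFrom1 (suc n) f = sumFrom1 n f ℤ.+ f (suc n)

module Submission where

open import Defs
open import Data.Nat using (ℕ; _≥_; _*_; _+_)
open import Data.Nat.Combinatorics using (_C_)
open import Data.Integer as ℤ using (ℤ; +_)
open import Relation.Binary.PropositionalEquality using (_≡_)

open import Data.Nat as ℕ using (zero; suc; _∸_; _≤_; _<_; _%_; s≤s)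
import Data.Nat.Properties as ℕ
open import Data.Nat.DivMod using ([m+n]%n≡m%n; [m+kn]%n≡m%n; %-distribˡ-*; m%n<n)
open import Data.Nat.Combinatorics using (nCk≡nC[n∸k]; k>n⇒nCk≡0; nCk+nC[k+1]≡[n+1]C[k+1])
import Data.Nat.Tactic.RingSolver as ℕ-Ring
import Data.Integer.Properties as ℤ
open import Data.Integer.Tactic.RingSolver using (solve-∀)
open import Algebra.Properties.CommutativeSemigroup ℤ.+-commutativeSemigroup using (interchange)
open import Data.Product using (_,_)
open import Function using (_∘_)
open import Relation.Binary.PropositionalEquality using (refl; sym; trans; cong; cong₂; subst; module ≡-Reasoning)

-- With Δf(i) = f(i) + f(i+1), the binomial transform ∑ᵢ C(N,i) f(i+j) is (Δᴺf)(j).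
-- Δ² sends the 5-periodic sequence 2p, q−p, −q, −q, q−p (profile5 p q) to the
-- sequence of the same shape for (q+p, 2q+p), shifted by one place. Since χ = (·/5)
-- is profile5 0 1, this gives ∑ᵢ C(2n,i) χ(i+j) = profile5 F₂ₙ F₂ₙ₊₁ (j+n), and
-- j = 4n ≡ −n (mod 5) yields 2F₂ₙ = ∑ᵢ C(2n,i) χ(i−n). Folding this sum about i = n,
-- where χ(0) = 0, and using that χ is even gives twice the right-hand side.

sumTo : ℕ → (ℕ → ℤ) → ℤ
sumTo zero    g = g 0
sumTo (suc N) g = sumTo N g ℤ.+ g (suc N)

sumTo-cong : ∀ N {f g : ℕ → ℤ} → (∀ i → f i ≡ g i) → sumTo N f ≡ sumTo N g
sumTo-cong zero    f≡g = f≡g 0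
sumTo-cong (suc N) f≡g = cong₂ ℤ._+_ (sumTo-cong N f≡g) (f≡g (suc N))

sumTo-+ : ∀ N (f g : ℕ → ℤ) → sumTo N (λ i → f i ℤ.+ g i) ≡ sumTo N f ℤ.+ sumTo N g
sumTo-+ zero    f g = refl
sumTo-+ (suc N) f g =
  trans (cong (ℤ._+ (f (suc N) ℤ.+ g (suc N))) (sumTo-+ N f g))
        (interchange (sumTo N f) (sumTo N g) (f (suc N)) (g (suc N)))

sumTo-suc : ∀ N (g : ℕ → ℤ) → sumTo (suc N) g ≡ g 0 ℤ.+ sumTo N (g ∘ suc)
sumTo-suc zero    g = refl
sumTo-suc (suc N) g =
  trans (cong (ℤ._+ g (2 + N)) (sumTo-suc N g)) (ℤ.+-assoc (g 0) (sumTo N (g ∘ suc)) (g (2 + N)))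

sumFrom1-cong : ∀ n {f g : ℕ → ℤ} → (∀ k → k ≤ n → f k ≡ g k) → sumFrom1 n f ≡ sumFrom1 n g
sumFrom1-cong zero    f≡g = refl
sumFrom1-cong (suc n) f≡g =
  cong₂ ℤ._+_ (sumFrom1-cong n (λ k k≤n → f≡g k (ℕ.m≤n⇒m≤1+n k≤n))) (f≡g (suc n) ℕ.≤-refl)

sumFrom1-+ : ∀ n (f g : ℕ → ℤ) → sumFrom1 n (λ k → f k ℤ.+ g k) ≡ sumFrom1 n f ℤ.+ sumFrom1 n g
sumFrom1-+ zero    f g = refl
sumFrom1-+ (suc n) f g =
  trans (cong (ℤ._+ (f (suc n) ℤ.+ g (suc n))) (sumFrom1-+ n f g))
        (interchange (sumFrom1 n f) (sumFrom1 n g) (f (suc n)) (g (suc n)))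

sumTo-fold : ∀ n (g : ℕ → ℤ) →
  sumTo (n + n) g ≡ g n ℤ.+ sumFrom1 n (λ k → g (n + k) ℤ.+ g (n ∸ k))
sumTo-fold zero    g = sym (ℤ.+-identityʳ (g 0))
sumTo-fold (suc n) g = begin
  sumTo (suc n + suc n) g
    ≡⟨ cong (λ m → sumTo (suc m) g) (ℕ.+-suc n n) ⟩
  sumTo (suc (n + n)) g ℤ.+ g (2 + (n + n))
    ≡⟨ cong (ℤ._+ g (2 + (n + n))) (sumTo-suc (n + n) g) ⟩
  (g 0 ℤ.+ sumTo (n + n) (g ∘ suc)) ℤ.+ g (2 + (n + n))
    ≡⟨ cong (λ s → (g 0 ℤ.+ s) ℤ.+ g (2 + (n + n))) (sumTo-fold n (g ∘ suc)) ⟩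
  (g 0 ℤ.+ (g (suc n) ℤ.+ inner)) ℤ.+ g (2 + (n + n))
    ≡⟨ rearrange (g 0) (g (suc n)) inner (g (2 + (n + n))) ⟩
  g (suc n) ℤ.+ (inner ℤ.+ (g (2 + (n + n)) ℤ.+ g 0))
    ≡⟨ cong₂ (λ s c → g (suc n) ℤ.+ (s ℤ.+ c)) inner≡
             (cong₂ (λ m o → g (suc m) ℤ.+ g o) (sym (ℕ.+-suc n n)) (sym (ℕ.n∸n≡0 n))) ⟩
  g (suc n) ℤ.+ sumFrom1 (suc n) (λ k → g (suc n + k) ℤ.+ g (suc n ∸ k)) ∎
  where
  open ≡-Reasoning
  inner : ℤ
  inner = sumFrom1 n (λ k → g (suc (n + k)) ℤ.+ g (suc (n ∸ k)))
  inner≡ : inner ≡ sumFrom1 n (λ k → g (suc n + k) ℤ.+ g (suc n ∸ k))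
  inner≡ = sumFrom1-cong n (λ k k≤n → cong (λ i → g (suc (n + k)) ℤ.+ g i) (sym (ℕ.+-∸-assoc 1 k≤n)))
  rearrange : ∀ a b s c → (a ℤ.+ (b ℤ.+ s)) ℤ.+ c ≡ b ℤ.+ (s ℤ.+ (c ℤ.+ a))
  rearrange = solve-∀

binomialTransform : ℕ → (ℕ → ℤ) → ℤ
binomialTransform N f = sumTo N (λ i → + (N C i) ℤ.* f i)

binomialTransform-cong : ∀ N {f g : ℕ → ℤ} → (∀ i → f i ≡ g i) →
  binomialTransform N f ≡ binomialTransform N g
binomialTransform-cong N f≡g = sumTo-cong N (λ i → cong (+ (N C i) ℤ.*_) (f≡g i))

binomialTransform-suc : ∀ N (f : ℕ → ℤ) →
  binomialTransform (suc N) f ≡ binomialTransform N f ℤ.+ binomialTransform N (f ∘ suc)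
binomialTransform-suc N f = begin
  binomialTransform (suc N) f
    ≡⟨ sumTo-suc N _ ⟩
  + 1 ℤ.* f 0 ℤ.+ sumTo N (λ i → + (suc N C suc i) ℤ.* f (suc i))
    ≡⟨ cong (ℤ._+_ (+ 1 ℤ.* f 0)) (trans (sumTo-cong N pascal) (sumTo-+ N _ _)) ⟩
  + 1 ℤ.* f 0 ℤ.+ (sumTo N (λ i → term (suc i)) ℤ.+ binomialTransform N (f ∘ suc))
    ≡⟨ sym (ℤ.+-assoc (+ 1 ℤ.* f 0) _ _) ⟩
  (term 0 ℤ.+ sumTo N (term ∘ suc)) ℤ.+ binomialTransform N (f ∘ suc)
    ≡⟨ cong (ℤ._+ binomialTransform N (f ∘ suc)) (sym (sumTo-suc N term)) ⟩
  sumTo (suc N) term ℤ.+ binomialTransform N (f ∘ suc)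
    ≡⟨ cong (λ c → sumTo N term ℤ.+ + c ℤ.* f (suc N) ℤ.+ binomialTransform N (f ∘ suc))
            (k>n⇒nCk≡0 (ℕ.n<1+n N)) ⟩
  sumTo N term ℤ.+ + 0 ℤ.+ binomialTransform N (f ∘ suc)
    ≡⟨ cong (ℤ._+ binomialTransform N (f ∘ suc)) (ℤ.+-identityʳ (sumTo N term)) ⟩
  binomialTransform N f ℤ.+ binomialTransform N (f ∘ suc) ∎
  where
  open ≡-Reasoning
  term : ℕ → ℤ
  term i = + (N C i) ℤ.* f i
  pascal : ∀ i → + (suc N C suc i) ℤ.* f (suc i) ≡ term (suc i) ℤ.+ + (N C i) ℤ.* f (suc i)
  pascal i = begin
    + (suc N C suc i) ℤ.* f (suc i)
      ≡⟨ cong (λ c → + c ℤ.* f (suc i)) (sym (nCk+nC[k+1]≡[n+1]C[k+1] N i)) ⟩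
    (+ (N C i) ℤ.+ + (N C suc i)) ℤ.* f (suc i)
      ≡⟨ ℤ.*-distribʳ-+ (f (suc i)) (+ (N C i)) (+ (N C suc i)) ⟩
    + (N C i) ℤ.* f (suc i) ℤ.+ term (suc i)
      ≡⟨ ℤ.+-comm (+ (N C i) ℤ.* f (suc i)) (term (suc i)) ⟩
    term (suc i) ℤ.+ + (N C i) ℤ.* f (suc i) ∎

binomialTransform-shift : ∀ N (f : ℕ → ℤ) j →
  binomialTransform (suc N) (λ i → f (i + j)) ≡
  binomialTransform N (λ i → f (i + j)) ℤ.+ binomialTransform N (λ i → f (i + suc j))
binomialTransform-shift N f j =
  trans (binomialTransform-suc N _)
        (cong (ℤ._+_ (binomialTransform N (λ i → f (i + j))))
              (binomialTransform-cong N (λ i → cong f (sym (ℕ.+-suc i j)))))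

profile5 : ℤ → ℤ → ℕ → ℤ
profile5 p q 0 = p ℤ.+ p
profile5 p q 1 = q ℤ.- p
profile5 p q 2 = ℤ.- q
profile5 p q 3 = ℤ.- q
profile5 p q 4 = q ℤ.- p
profile5 p q (suc (suc (suc (suc (suc t))))) = profile5 p q t

profile5-5* : ∀ p q m → profile5 p q (5 * m) ≡ p ℤ.+ p
profile5-5* p q zero    = refl
profile5-5* p q (suc m) = trans (cong (profile5 p q) (ℕ.*-suc 5 m)) (profile5-5* p q m)

profile5-Δ² : ∀ p q t →
  (profile5 p q t ℤ.+ profile5 p q (1 + t)) ℤ.+ (profile5 p q (1 + t) ℤ.+ profile5 p q (2 + t))
    ≡ profile5 (q ℤ.+ p) ((q ℤ.+ p) ℤ.+ q) (1 + t)
profile5-Δ² p q 0 = case0 p q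
  where case0 : ∀ p q → ((p ℤ.+ p) ℤ.+ (q ℤ.- p)) ℤ.+ ((q ℤ.- p) ℤ.+ ℤ.- q) ≡ ((q ℤ.+ p) ℤ.+ q) ℤ.- (q ℤ.+ p)
        case0 = solve-∀
profile5-Δ² p q 1 = case1 p q
  where case1 : ∀ p q → ((q ℤ.- p) ℤ.+ ℤ.- q) ℤ.+ (ℤ.- q ℤ.+ ℤ.- q) ≡ ℤ.- ((q ℤ.+ p) ℤ.+ q)
        case1 = solve-∀
profile5-Δ² p q 2 = case2 p q
  where case2 : ∀ p q → (ℤ.- q ℤ.+ ℤ.- q) ℤ.+ (ℤ.- q ℤ.+ (q ℤ.- p)) ≡ ℤ.- ((q ℤ.+ p) ℤ.+ q)
        case2 = solve-∀
profile5-Δ² p q 3 = case3 p q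
  where case3 : ∀ p q → (ℤ.- q ℤ.+ (q ℤ.- p)) ℤ.+ ((q ℤ.- p) ℤ.+ (p ℤ.+ p)) ≡ ((q ℤ.+ p) ℤ.+ q) ℤ.- (q ℤ.+ p)
        case3 = solve-∀
profile5-Δ² p q 4 = case4 p q
  where case4 : ∀ p q → ((q ℤ.- p) ℤ.+ (p ℤ.+ p)) ℤ.+ ((p ℤ.+ p) ℤ.+ (q ℤ.- p)) ≡ (q ℤ.+ p) ℤ.+ (q ℤ.+ p)
        case4 = solve-∀
profile5-Δ² p q (suc (suc (suc (suc (suc t))))) = profile5-Δ² p q t

binomialTransform-profile5-step : ∀ N (f : ℕ → ℤ) p q m →
  (∀ j → binomialTransform N (λ i → f (i + j)) ≡ profile5 p q (j + m)) →
  ∀ j → binomialTransform (2 + N) (λ i → f (i + j)) ≡ profile5 (q ℤ.+ p) ((q ℤ.+ p) ℤ.+ q) (j + suc m)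
binomialTransform-profile5-step N f p q m hyp j = begin
  T (2 + N) j
    ≡⟨ binomialTransform-shift (suc N) f j ⟩
  T (suc N) j ℤ.+ T (suc N) (suc j)
    ≡⟨ cong₂ ℤ._+_ (binomialTransform-shift N f j) (binomialTransform-shift N f (suc j)) ⟩
  (T N j ℤ.+ T N (1 + j)) ℤ.+ (T N (1 + j) ℤ.+ T N (2 + j))
    ≡⟨ cong₂ ℤ._+_ (cong₂ ℤ._+_ (hyp j) (hyp (1 + j))) (cong₂ ℤ._+_ (hyp (1 + j)) (hyp (2 + j))) ⟩
  (profile5 p q (j + m) ℤ.+ profile5 p q (1 + j + m)) ℤ.+ (profile5 p q (1 + j + m) ℤ.+ profile5 p q (2 + j + m))
    ≡⟨ profile5-Δ² p q (j + m) ⟩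
  profile5 (q ℤ.+ p) ((q ℤ.+ p) ℤ.+ q) (1 + j + m)
    ≡⟨ cong (profile5 (q ℤ.+ p) ((q ℤ.+ p) ℤ.+ q)) (sym (ℕ.+-suc j m)) ⟩
  profile5 (q ℤ.+ p) ((q ℤ.+ p) ℤ.+ q) (j + suc m) ∎
  where
  open ≡-Reasoning
  T : ℕ → ℕ → ℤ
  T M j = binomialTransform M (λ i → f (i + j))

legendre5-+5 : ∀ k → legendre5 (5 + k) ≡ legendre5 k
legendre5-+5 k = cong legendre5Res (trans (cong (_% 5) (ℕ.+-comm 5 k)) ([m+n]%n≡m%n k 5))

legendre5≡profile5 : ∀ t → legendre5 t ≡ profile5 (+ 0) (+ 1) t
legendre5≡profile5 0 = refl
legendre5≡profile5 1 = refl
legendre5≡profile5 2 = refl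
legendre5≡profile5 3 = refl
legendre5≡profile5 4 = refl
legendre5≡profile5 (suc (suc (suc (suc (suc t))))) = trans (legendre5-+5 t) (legendre5≡profile5 t)

binomialTransform-legendre5 : ∀ n j →
  binomialTransform (2 * n) (λ i → legendre5 (i + j)) ≡ profile5 (+ fib (2 * n)) (+ fib (suc (2 * n))) (j + n)
binomialTransform-legendre5 zero    j = begin
  + 1 ℤ.* legendre5 j       ≡⟨ ℤ.*-identityˡ (legendre5 j) ⟩
  legendre5 j               ≡⟨ legendre5≡profile5 j ⟩
  profile5 (+ 0) (+ 1) j    ≡⟨ cong (profile5 (+ 0) (+ 1)) (sym (ℕ.+-identityʳ j)) ⟩
  profile5 (+ 0) (+ 1) (j + 0) ∎
  where open ≡-Reasoning
binomialTransform-legendre5 (suc n) j =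
  subst (λ N → binomialTransform N (λ i → legendre5 (i + j)) ≡ profile5 (+ fib N) (+ fib (suc N)) (j + suc n))
        (sym (ℕ.*-suc 2 n))
        (binomialTransform-profile5-step (2 * n) legendre5 _ _ n (binomialTransform-legendre5 n) j)

legendre5-+*5 : ∀ k m → legendre5 (k + m * 5) ≡ legendre5 k
legendre5-+*5 k m = cong legendre5Res ([m+kn]%n≡m%n k m 5)

legendre5-4* : ∀ k → legendre5 (4 * k) ≡ legendre5 k
legendre5-4* k = trans (cong legendre5Res (%-distribˡ-* 4 k 5)) (residue (k % 5) (m%n<n k 5))
  where
  residue : ∀ r → r < 5 → legendre5Res ((4 * r) % 5) ≡ legendre5Res r
  residue 0 _ = refl
  residue 1 _ = refl
  residue 2 _ = refl
  residue 3 _ = refl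
  residue 4 _ = refl
  residue (suc (suc (suc (suc (suc _))))) (s≤s (s≤s (s≤s (s≤s (s≤s ())))))

centredTerm : ℕ → ℕ → ℤ
centredTerm n i = + ((2 * n) C i) ℤ.* legendre5 (i + 4 * n)

legendreTerm : ℕ → ℕ → ℤ
legendreTerm n k = + ((2 * n) C (n + k)) ℤ.* legendre5 k

centredTerm-centre : ∀ n → centredTerm n n ≡ + 0
centredTerm-centre n = begin
  + ((2 * n) C n) ℤ.* legendre5 (n + 4 * n) ≡⟨ cong (λ i → + ((2 * n) C n) ℤ.* legendre5 i) (n+4n≡0+n*5 n) ⟩
  + ((2 * n) C n) ℤ.* legendre5 (0 + n * 5) ≡⟨ cong (+ ((2 * n) C n) ℤ.*_) (legendre5-+*5 0 n) ⟩
  + ((2 * n) C n) ℤ.* + 0                   ≡⟨ ℤ.*-zeroʳ (+ ((2 * n) C n)) ⟩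
  + 0 ∎
  where
  open ≡-Reasoning
  n+4n≡0+n*5 : ∀ n → n + 4 * n ≡ 0 + n * 5
  n+4n≡0+n*5 = ℕ-Ring.solve-∀

centredTerm-pair : ∀ n k → k ≤ n → centredTerm n (n + k) ℤ.+ centredTerm n (n ∸ k) ≡ legendreTerm n k ℤ.+ legendreTerm n k
centredTerm-pair n k k≤n with ℕ.m≤n⇒∃[o]m+o≡n k≤n
... | d , refl rewrite ℕ.m+n∸m≡n k d = cong₂ ℤ._+_ upper lower
  where
  upper : centredTerm n (n + k) ≡ legendreTerm n k
  upper = cong (+ ((2 * n) C (n + k)) ℤ.*_)
               (trans (cong legendre5 (index k d)) (legendre5-+*5 k n))
    where index : ∀ k d → (k + d) + k + 4 * (k + d) ≡ k + (k + d) * 5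
          index = ℕ-Ring.solve-∀
  lower : centredTerm n d ≡ legendreTerm n k
  lower = cong₂ ℤ._*_ (cong +_ (trans (nCk≡nC[n∸k] d≤2n) (cong ((2 * n) C_) 2n∸d≡n+k)))
                      (trans (cong legendre5 (index k d)) (trans (legendre5-+*5 (4 * k) d) (legendre5-4* k)))
    where index : ∀ k d → d + 4 * (k + d) ≡ 4 * k + d * 5
          index = ℕ-Ring.solve-∀
          2n≡n+k+d : ∀ k d → 2 * (k + d) ≡ (k + d) + k + d
          2n≡n+k+d = ℕ-Ring.solve-∀
          d≤2n : d ≤ 2 * n
          d≤2n = subst (d ≤_) (sym (2n≡n+k+d k d)) (ℕ.m≤n+m d (n + k))
          2n∸d≡n+k : 2 * n ∸ d ≡ n + k
          2n∸d≡n+k = trans (cong (_∸ d) (2n≡n+k+d k d)) (ℕ.m+n∸n≡m (n + k) d)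

binomialTransform-centred-legendre5 : ∀ n →
  binomialTransform (2 * n) (λ i → legendre5 (i + 4 * n)) ≡ sumFrom1 n (legendreTerm n) ℤ.+ sumFrom1 n (legendreTerm n)
binomialTransform-centred-legendre5 n = begin
  sumTo (2 * n) (centredTerm n)
    ≡⟨ cong (λ m → sumTo (n + m) (centredTerm n)) (ℕ.+-identityʳ n) ⟩
  sumTo (n + n) (centredTerm n)
    ≡⟨ sumTo-fold n (centredTerm n) ⟩
  centredTerm n n ℤ.+ sumFrom1 n (λ k → centredTerm n (n + k) ℤ.+ centredTerm n (n ∸ k))
    ≡⟨ cong₂ ℤ._+_ (centredTerm-centre n) (sumFrom1-cong n (centredTerm-pair n)) ⟩
  + 0 ℤ.+ sumFrom1 n (λ k → legendreTerm n k ℤ.+ legendreTerm n k)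
    ≡⟨ ℤ.+-identityˡ _ ⟩
  sumFrom1 n (λ k → legendreTerm n k ℤ.+ legendreTerm n k)
    ≡⟨ sumFrom1-+ n (legendreTerm n) (legendreTerm n) ⟩
  sumFrom1 n (legendreTerm n) ℤ.+ sumFrom1 n (legendreTerm n) ∎
  where open ≡-Reasoning

double-injective : ∀ a b → a ℤ.+ a ≡ b ℤ.+ b → a ≡ b
double-injective a b a+a≡b+b =
  ℤ.*-cancelˡ-≡ (+ 2) a b (trans (double a) (trans a+a≡b+b (sym (double b))))
  where double : ∀ x → + 2 ℤ.* x ≡ x ℤ.+ x
        double = solve-∀

mainTheorem1 : ∀ (n : ℕ) → n ≥ 1 →
    + fib (2 * n) ≡ sumFrom1 n (λ k → (+ ((2 * n) C (n + k))) ℤ.* legendre5 k)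
mainTheorem1 n _ = double-injective (+ fib (2 * n)) (sumFrom1 n (legendreTerm n)) (begin
  F ℤ.+ F
    ≡⟨ sym (profile5-5* F F′ n) ⟩
  profile5 F F′ (5 * n)
    ≡⟨ cong (profile5 F F′) (5n≡4n+n n) ⟩
  profile5 F F′ (4 * n + n)
    ≡⟨ sym (binomialTransform-legendre5 n (4 * n)) ⟩
  binomialTransform (2 * n) (λ i → legendre5 (i + 4 * n))
    ≡⟨ binomialTransform-centred-legendre5 n ⟩
  sumFrom1 n (legendreTerm n) ℤ.+ sumFrom1 n (legendreTerm n) ∎)
  where
  open ≡-Reasoning
  F F′ : ℤ
  F  = + fib (2 * n)
  F′ = + fib (suc (2 * n))
  5n≡4n+n : ∀ n → 5 * n ≡ 4 * n + n
  5n≡4n+n = ℕ-Ring.solve-∀
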